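{- Let $d\ge 1$, let $\psi(\overline{\sigma})$ and $\varphi(\overline{k})$ be Presburger arithmetic formulas in $d$-tuples of natural-number variables. Then the formula \[ \exists \overline{\sigma}\in\mathbb{N}^d,\ \exists \overline{c}:\mathbb{N}\to\mathbb{N}^d.\ \psi(\overline{\sigma}) \land \overline{\sigma} = \sum_{n \in \mathbb{N}} \{\!\{ \overline{c}(n) \mid \varphi(\overline{c}(n)) \}\!\} \] is equivalent to the formula \[ \exists \overline{\sigma}\in\mathbb{N}^d.\ \psi(\overline{\sigma}) \land \overline{\sigma} \in \{\overline{k} \mid \varphi(\overline{k})\}^*. \]
   Context: $\sum_{n\in\mathbb{N}}\{\!\{ \overline{c}(n) \mid \varphi(\overline{c}(n))\}\!\}$ denotes the componentwise sum of the multiset of vectors $\overline{c}(n)$, over all indices $n\in\mathbb{N}$ such that $\varphi(\overline{c}(n))$ holds; the equation with $\overline{\sigma}\in\mathbb{N}^d$ requires this sum to be finite. For a set $A\subseteq\mathbb{N}^d$, $A^* = \{ u \mid \exists N \ge 0,\ x_1,\ldots,x_N \in A.\ u = \sum_{i=1}^N x_i \}$ (the empty sum being $0$). -}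

module Defs where

open import Data.Nat using (ℕ; _+_; _≤_; _<_)
open import Data.Fin using (Fin; zero; suc)
open import Data.Vec using (Vec; []; _∷_; zipWith; replicate; lookup)
open import Data.List using (List; []; _∷_; map; foldr)
open import Data.List.Relation.Unary.All using (All)
open import Data.List.Relation.Unary.Unique.Propositional using (Unique)
open import Data.Product using (Σ; ∃; _×_; _,_)
open import Data.Sum using (_⊎_)
open import Data.Empty using (⊥)
open import Relation.Nullary using (¬_)
open import Relation.Binary.PropositionalEquality using (_≡_)

-- A formula of type `Formula n`
-- has (at most) n free variables, numbered by Fin n; the binders
-- `ex`/`all` extend the context by one variable (index zero).

data Term (n : ℕ) : Set where
  var  : Fin n → Term n
  zer  : Term n
  one  : Term n
  _⊕_  : Term n → Term n → Term n

data Formula (n : ℕ) : Set where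
  _≐_  : Term n → Term n → Formula n
  _≺_  : Term n → Term n → Formula n
  ¬'_  : Formula n → Formula n
  _∧'_ : Formula n → Formula n → Formula n
  _∨'_ : Formula n → Formula n → Formula n
  ex   : Formula (Data.Nat.suc n) → Formula n
  all  : Formula (Data.Nat.suc n) → Formula n

Env : ℕ → Set
Env n = Fin n → ℕ

extend : ∀ {n} → ℕ → Env n → Env (Data.Nat.suc n)
extend a ρ zero    = a
extend a ρ (suc i) = ρ i

evalT : ∀ {n} → Term n → Env n → ℕ
evalT (var i) ρ = ρ i
evalT zer     ρ = 0
evalT one     ρ = 1
evalT (s ⊕ t) ρ = evalT s ρ + evalT t ρ

⟦_⟧ : ∀ {n} → Formula n → Env n → Set
⟦ s ≐ t ⟧  ρ = evalT s ρ ≡ evalT t ρ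
⟦ s ≺ t ⟧  ρ = evalT s ρ < evalT t ρ
⟦ ¬' φ ⟧   ρ = ¬ ⟦ φ ⟧ ρ
⟦ φ ∧' ψ ⟧ ρ = ⟦ φ ⟧ ρ × ⟦ ψ ⟧ ρ
⟦ φ ∨' ψ ⟧ ρ = ⟦ φ ⟧ ρ ⊎ ⟦ ψ ⟧ ρ
⟦ ex φ ⟧   ρ = ∃ λ (a : ℕ) → ⟦ φ ⟧ (extend a ρ)
⟦ all φ ⟧  ρ = (a : ℕ) → ⟦ φ ⟧ (extend a ρ)

_⊨_ : ∀ {d} → Formula d → Vec ℕ d → Set
φ ⊨ v = ⟦ φ ⟧ (lookup v)

_+ᵥ_ : ∀ {d} → Vec ℕ d → Vec ℕ d → Vec ℕ d
_+ᵥ_ = zipWith _+_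

0ᵥ : ∀ {d} → Vec ℕ d
0ᵥ = replicate _ 0

sumᵥ : ∀ {d} → List (Vec ℕ d) → Vec ℕ d
sumᵥ = foldr _+ᵥ_ 0ᵥ

_≤ᵥ_ : ∀ {d} → Vec ℕ d → Vec ℕ d → Set
u ≤ᵥ v = ∀ i → lookup u i ≤ lookup v i

-- The sum of a family of nonnegative vectors over an infinite index set
-- is the supremum of its finite partial sums; it is finite and equal to σ
-- iff every finite partial sum (over a finite set of distinct indices n
-- with φ(c(n))) is ≤ σ componentwise, and some finite partial sum equals σ.

IsFilteredSum : ∀ {d} → Formula d → (ℕ → Vec ℕ d) → Vec ℕ d → Set
IsFilteredSum φ c σ =
  ((L : List ℕ) → Unique L → All (λ n → φ ⊨ c n) L → sumᵥ (map c L) ≤ᵥ σ)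
  × (∃ λ (L : List ℕ) → Unique L × All (λ n → φ ⊨ c n) L × sumᵥ (map c L) ≡ σ)

Star : ∀ {d} → (Vec ℕ d → Set) → Vec ℕ d → Set
Star A u = ∃ λ (xs : List (Vec ℕ _)) → All A xs × u ≡ sumᵥ xs

{-# OPTIONS --safe #-}
-- A family c : ℕ → ℕᵈ with filtered sum σ has a finite set of distinct indices whose
-- vectors satisfy φ and add up to σ, so σ ∈ {k | φ k}*. Conversely, a decomposition
-- σ = x₀ + … + x_{N-1} becomes the family n ↦ xₙ, padded with 0 beyond N; any sum
-- of that family over distinct indices picks each xₙ at most once, hence is ≤ σ.
module Submission where

open import Defs
open import Data.Nat using (ℕ; _≤_; _+_; z≤n; zero; suc)
open import Data.Nat.Properties as ℕ using (+-monoʳ-≤)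
open import Data.Vec using (Vec; lookup)
open import Data.Vec.Properties
  using (lookup-zipWith; lookup-replicate; zipWith-assoc; zipWith-comm; zipWith-identityˡ)
open import Data.List using (List; []; _∷_; map; length; upTo; applyUpTo)
open import Data.List.Properties using (map-cong-local; map-upTo)
open import Data.List.Relation.Unary.All using (All)
import Data.List.Relation.Unary.All as All
open import Data.List.Relation.Unary.All.Properties using (map⁺; map⁻)
open import Data.List.Relation.Unary.AllPairs using ([]; _∷_)
open import Data.List.Relation.Unary.Unique.Propositional using (Unique)
open import Data.List.Relation.Unary.Unique.Propositional.Properties using (upTo⁺)
open import Data.Product using (∃; _×_; _,_)
open import Function.Bundles using (_⇔_; mk⇔)
open import Relation.Binary.PropositionalEquality
  using (_≡_; _≢_; refl; sym; trans; cong; subst; module ≡-Reasoning)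

private variable
  d : ℕ

+ᵥ-assoc : (u v w : Vec ℕ d) → (u +ᵥ v) +ᵥ w ≡ u +ᵥ (v +ᵥ w)
+ᵥ-assoc = zipWith-assoc ℕ.+-assoc

+ᵥ-comm : (u v : Vec ℕ d) → u +ᵥ v ≡ v +ᵥ u
+ᵥ-comm = zipWith-comm ℕ.+-comm

+ᵥ-identityˡ : (u : Vec ℕ d) → 0ᵥ +ᵥ u ≡ u
+ᵥ-identityˡ = zipWith-identityˡ ℕ.+-identityˡ

+ᵥ-leftComm : (u v w : Vec ℕ d) → u +ᵥ (v +ᵥ w) ≡ v +ᵥ (u +ᵥ w)
+ᵥ-leftComm u v w = begin
  u +ᵥ (v +ᵥ w)   ≡⟨ sym (+ᵥ-assoc u v w) ⟩
  (u +ᵥ v) +ᵥ w   ≡⟨ cong (_+ᵥ w) (+ᵥ-comm u v) ⟩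
  (v +ᵥ u) +ᵥ w   ≡⟨ +ᵥ-assoc v u w ⟩
  v +ᵥ (u +ᵥ w)   ∎
  where open ≡-Reasoning

≤ᵥ-reflexive : {u v : Vec ℕ d} → u ≡ v → u ≤ᵥ v
≤ᵥ-reflexive refl i = ℕ.≤-refl

0ᵥ-minimum : (u : Vec ℕ d) → 0ᵥ ≤ᵥ u
0ᵥ-minimum u i rewrite lookup-replicate i 0 = z≤n

≤ᵥ-trans : {u v w : Vec ℕ d} → u ≤ᵥ v → v ≤ᵥ w → u ≤ᵥ w
≤ᵥ-trans u≤v v≤w i = ℕ.≤-trans (u≤v i) (v≤w i)

+ᵥ-monoʳ-≤ᵥ : (w : Vec ℕ d) {u v : Vec ℕ d} → u ≤ᵥ v → (w +ᵥ u) ≤ᵥ (w +ᵥ v)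
+ᵥ-monoʳ-≤ᵥ w {u} {v} u≤v i
  rewrite lookup-zipWith _+_ i w u | lookup-zipWith _+_ i w v
  = +-monoʳ-≤ (lookup w i) (u≤v i)

at : List (Vec ℕ d) → ℕ → Vec ℕ d
at []       _       = 0ᵥ
at (x ∷ xs) zero    = x
at (x ∷ xs) (suc n) = at xs n

zeroAt : List (Vec ℕ d) → ℕ → List (Vec ℕ d)
zeroAt []       _       = []
zeroAt (x ∷ xs) zero    = 0ᵥ ∷ xs
zeroAt (x ∷ xs) (suc n) = x ∷ zeroAt xs n

at-zeroAt-≢ : (xs : List (Vec ℕ d)) {a n : ℕ} → a ≢ n → at (zeroAt xs a) n ≡ at xs n
at-zeroAt-≢ []       a≢n = refl
at-zeroAt-≢ (x ∷ xs) {zero}  {zero}  a≢n with () ← a≢n refl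
at-zeroAt-≢ (x ∷ xs) {zero}  {suc n} a≢n = refl
at-zeroAt-≢ (x ∷ xs) {suc a} {zero}  a≢n = refl
at-zeroAt-≢ (x ∷ xs) {suc a} {suc n} a≢n = at-zeroAt-≢ xs (λ a≡n → a≢n (cong suc a≡n))

sumᵥ-zeroAt : (xs : List (Vec ℕ d)) (a : ℕ) → at xs a +ᵥ sumᵥ (zeroAt xs a) ≡ sumᵥ xs
sumᵥ-zeroAt []       a       = +ᵥ-identityˡ 0ᵥ
sumᵥ-zeroAt (x ∷ xs) zero    = cong (x +ᵥ_) (+ᵥ-identityˡ (sumᵥ xs))
sumᵥ-zeroAt (x ∷ xs) (suc a) =
  trans (+ᵥ-leftComm (at xs a) x _) (cong (x +ᵥ_) (sumᵥ-zeroAt xs a))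

sumᵥ-at-distinct : (xs : List (Vec ℕ d)) {L : List ℕ} → Unique L →
                   sumᵥ (map (at xs) L) ≤ᵥ sumᵥ xs
sumᵥ-at-distinct xs {[]}    []          = 0ᵥ-minimum (sumᵥ xs)
sumᵥ-at-distinct xs {a ∷ L} (a∉L ∷ uL) =
  ≤ᵥ-trans {u = sumᵥ (map (at xs) (a ∷ L))} {at xs a +ᵥ sumᵥ (zeroAt xs a)} {sumᵥ xs}
    (+ᵥ-monoʳ-≤ᵥ (at xs a) rest≤) (≤ᵥ-reflexive (sumᵥ-zeroAt xs a))
  where
  rest≤ : sumᵥ (map (at xs) L) ≤ᵥ sumᵥ (zeroAt xs a)
  rest≤ = subst (λ s → s ≤ᵥ sumᵥ (zeroAt xs a))
    (cong sumᵥ (map-cong-local (All.map (at-zeroAt-≢ xs) a∉L)))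
    (sumᵥ-at-distinct (zeroAt xs a) uL)

applyUpTo-at-length : (xs : List (Vec ℕ d)) → applyUpTo (at xs) (length xs) ≡ xs
applyUpTo-at-length []       = refl
applyUpTo-at-length (x ∷ xs) = cong (x ∷_) (applyUpTo-at-length xs)

map-at-upTo : (xs : List (Vec ℕ d)) → map (at xs) (upTo (length xs)) ≡ xs
map-at-upTo xs = trans (map-upTo (at xs) (length xs)) (applyUpTo-at-length xs)

isFilteredSum-at : (φ : Formula d) (xs : List (Vec ℕ d)) →
                   All (φ ⊨_) xs → IsFilteredSum φ (at xs) (sumᵥ xs)
isFilteredSum-at φ xs φxs =
  (λ L uL _ → sumᵥ-at-distinct xs uL) ,
  (upTo (length xs) , upTo⁺ (length xs) ,
   map⁻ (subst (All (φ ⊨_)) (sym (map-at-upTo xs)) φxs) ,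
   cong sumᵥ (map-at-upTo xs))

isFilteredSum⇒star : (φ : Formula d) {c : ℕ → Vec ℕ d} {σ : Vec ℕ d} →
                     IsFilteredSum φ c σ → Star (φ ⊨_) σ
isFilteredSum⇒star φ {c} (_ , L , _ , φcL , ΣcL≡σ) = map c L , map⁺ φcL , sym ΣcL≡σ

star⇒isFilteredSum : (φ : Formula d) {σ : Vec ℕ d} →
                     Star (φ ⊨_) σ → ∃ λ (c : ℕ → Vec ℕ d) → IsFilteredSum φ c σ
star⇒isFilteredSum φ (xs , φxs , refl) = at xs , isFilteredSum-at φ xs φxs

mainTheorem2 : (d : ℕ) → 1 ≤ d → (ψ φ : Formula d) →
    (∃ λ (σ : Vec ℕ d) → ∃ λ (c : ℕ → Vec ℕ d) → ψ ⊨ σ × IsFilteredSum φ c σ)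
    ⇔ (∃ λ (σ : Vec ℕ d) → ψ ⊨ σ × Star (λ k → φ ⊨ k) σ)
mainTheorem2 d _ ψ φ = mk⇔
  (λ (σ , c , ψσ , σ=Σc) → σ , ψσ , isFilteredSum⇒star φ σ=Σc)
  (λ (σ , ψσ , σ∈φ*) → let c , σ=Σc = star⇒isFilteredSum φ σ∈φ* in σ , c , ψσ , σ=Σc)
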